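{- Let $D$ be a $7$-located simplicial disc. Let $W_1$ and $W_2$ be distinct wheels in $D$, each of boundary length less than $6$. Then $W_1\cap W_2\subset \partial W_1\cap\partial W_2$. In particular, the flattened wheel metric is well-defined for $D$.
   Context: A flag simplicial complex is one in which any finite set of pairwise adjacent vertices spans a simplex. A subcomplex $L$ is full if every simplex whose vertices lie in $L$ is contained in $L$. A cycle is a subcomplex isomorphic to a subdivision of $S^1$; its length is its number of edges. A $k$-wheel $W=(v_0;v_1,\dots,v_k)$ is a cycle $\partial W=(v_1,\dots,v_k)$ (its boundary, of length $k$) together with all triangles $\langle v_0,v_i,v_{i+1}\rangle$ (indices mod $k$); $v_0$ is its central vertex. A $(k,l)$-dwheel $W=W_1\cup W_2$ is the union of two wheels $W_1=(w_l;v_1,\dots,v_k)$ and $W_2=(v_2;w_1,\dots,w_l)$ with $v_3=w_{l-1}$ and either $v_1=w_1$ or $v_1$ adjacent to $w_1$; its boundary is the cycle $(w_1,\dots,w_{l-1}=v_3,v_4,\dots,v_k)$. A complex is $m$-located ($m\ge4$) if it is flag and every dwheel whose boundary has length at most $m$ and whose two wheels are full subcomplexes is contained in the link of some vertex (the link of $v$ being the subcomplex of simplices disjoint from $v$ that span a simplex with $v$). A $7$-located simplicial disc is a triangulated $2$-disc that is $7$-located. Flattened wheel metric on a $k$-wheel $W$: each triangle is metrized as a Euclidean triangle with angle $2\pi/k$ at the center, angles $(k-2)\pi/(2k)$ at the other two vertices, and boundary edge of length $1$. For a simplicial disc $D$ in which any two distinct $k_1$- and $k_2$-wheels with $k_1,k_2<6$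 meet only within their boundaries, the flattened wheel metric on $D$ is the piecewise Euclidean metric obtained by giving each $k$-wheel with $k<6$ its flattened wheel metric and every remaining triangle the metric of a regular Euclidean triangle of side length $1$. -}

module Defs where

open import Data.Nat using (ℕ; zero; suc; _+_; _≤_; _<_; _≡ᵇ_)
open import Data.Bool using (Bool; true; false; T; _∧_; not)
open import Data.Fin using (Fin; zero; suc; fromℕ; inject₁) renaming (_≟_ to _≟F_)
open import Data.Fin.Subset using (Subset; ⁅_⁆; _∪_; _∈_; _∉_; _⊆_; ∣_∣; Nonempty; inside; outside)
open import Data.Vec using ([]; _∷_)
open import Data.List using (List; [_]; map; _++_; filter; length; allFin)
open import Data.Product using (Σ; ∃; _×_; _,_)
open import Data.Sum using (_⊎_)
open import Relation.Nullary using (¬_)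
open import Relation.Nullary.Decidable using (⌊_⌋)
open import Relation.Binary.PropositionalEquality using (_≡_; _≢_)
open import Function.Definitions using (Injective)

record Complex (n : ℕ) : Set where
  field
    simplex   : Subset n → Bool
    nonempty  : ∀ σ → T (simplex σ) → Nonempty σ
    downward  : ∀ σ τ → T (simplex σ) → τ ⊆ σ → Nonempty τ → T (simplex τ)
    vertices  : ∀ (i : Fin n) → T (simplex ⁅ i ⁆)

module _ {n : ℕ} (D : Complex n) where
  open Complex D

  IsSimplex : Subset n → Set
  IsSimplex σ = T (simplex σ)

  edge : Fin n → Fin n → Subset n
  edge a b = ⁅ a ⁆ ∪ ⁅ b ⁆

  tri : Fin n → Fin n → Fin n → Subset n
  tri a b c = ⁅ a ⁆ ∪ ⁅ b ⁆ ∪ ⁅ c ⁆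

  Adjacent : Fin n → Fin n → Set
  Adjacent a b = a ≢ b × IsSimplex (edge a b)

  IsFlag : Set
  IsFlag = ∀ σ → Nonempty σ →
           (∀ i j → i ∈ σ → j ∈ σ → i ≢ j → IsSimplex (edge i j)) →
           IsSimplex σ

  -- subcomplexes are given as predicates on (nonempty) subsets
  -- L is full: every simplex of D all of whose vertices lie in L is in L
  IsFull : (Subset n → Set) → Set
  IsFull L = ∀ σ → IsSimplex σ → (∀ x → x ∈ σ → L ⁅ x ⁆) → L σ

  InLink : Fin n → Subset n → Set
  InLink v τ = Nonempty τ × v ∉ τ × IsSimplex (⁅ v ⁆ ∪ τ)

next : ∀ {m} → Fin (suc m) → Fin (suc m)
next {zero} zero = zero
next {suc m} zero = suc zero
next {suc m} (suc i) with next {m} i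
... | zero = zero
... | suc j = suc (suc j)

-- Wheels.  A wheel with boundary length 3 + ext is given by its central
-- vertex and its boundary cycle rim 0, …, rim (2+ext) (indices mod length).

record Wheel {n : ℕ} (D : Complex n) : Set where
  field
    ext      : ℕ
    center   : Fin n
    rim      : Fin (3 + ext) → Fin n
    rim-inj  : Injective _≡_ _≡_ rim
    center∉  : ∀ i → center ≢ rim i
    triangle : ∀ i → IsSimplex D (tri D center (rim i) (rim (next i)))

  len : ℕ
  len = 3 + ext

module _ {n : ℕ} {D : Complex n} (W : Wheel D) where
  open Wheel W

  InWheel : Subset n → Set
  InWheel σ = σ ≡ ⁅ center ⁆
            ⊎ (∃ λ i → σ ≡ ⁅ rim i ⁆
                      ⊎ σ ≡ edge D center (rim i)
                      ⊎ σ ≡ edge D (rim i) (rim (next i))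
                      ⊎ σ ≡ tri D center (rim i) (rim (next i)))

  InBoundary : Subset n → Set
  InBoundary σ = ∃ λ i → σ ≡ ⁅ rim i ⁆ ⊎ σ ≡ edge D (rim i) (rim (next i))

-- W₁ = (w_l; v₁,…,v_k), W₂ = (v₂; w₁,…,w_l) with v₃ = w_{l-1}
-- and v₁ = w₁ or v₁ adjacent to w₁.  0-based: v_{i+1} = rim W₁ i,
-- w_{j+1} = rim W₂ j.  Boundary (w₁,…,w_{l-1}=v₃,v₄,…,v_k) has length
-- (l-1)+(k-3) = k + l - 4 = ext W₁ + ext W₂ + 2.

module _ {n : ℕ} {D : Complex n} where
  IsDwheel : Wheel D → Wheel D → Set
  IsDwheel W₁ W₂ =
      Wheel.center W₁ ≡ Wheel.rim W₂ (fromℕ (2 + Wheel.ext W₂))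
    × Wheel.center W₂ ≡ Wheel.rim W₁ (suc zero)
    × Wheel.rim W₁ (suc (suc zero)) ≡ Wheel.rim W₂ (inject₁ (fromℕ (1 + Wheel.ext W₂)))
    × (Wheel.rim W₁ zero ≡ Wheel.rim W₂ zero
       ⊎ Adjacent D (Wheel.rim W₁ zero) (Wheel.rim W₂ zero))

  dwheelBoundaryLength : Wheel D → Wheel D → ℕ
  dwheelBoundaryLength W₁ W₂ = 2 + Wheel.ext W₁ + Wheel.ext W₂

Located : ℕ → ∀ {n} → Complex n → Set
Located m {n} D =
  IsFlag D ×
  (∀ (W₁ W₂ : Wheel D) → IsDwheel W₁ W₂ →
     dwheelBoundaryLength W₁ W₂ ≤ m →
     IsFull D (InWheel W₁) → IsFull D (InWheel W₂) →
     ∃ λ (v : Fin n) → ∀ σ → (InWheel W₁ σ ⊎ InWheel W₂ σ) → InLink D v σ)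

-- Triangulated 2-discs, combinatorially: a finite connected combinatorial
-- surface (every vertex link is a connected graph with all degrees 1 or 2,
-- i.e. a path with ≥ 1 edge or a cycle), of dimension ≤ 2, with nonempty
-- boundary and Euler characteristic 1.  (By the classification of compact
-- surfaces these are exactly the triangulations of the 2-disc.)

allSubsets : ∀ n → List (Subset n)
allSubsets zero = [ [] ]
allSubsets (suc n) = map (outside ∷_) (allSubsets n) ++ map (inside ∷_) (allSubsets n)

module _ {n : ℕ} (D : Complex n) where
  open Complex D

  numSimplices : ℕ → ℕ
  numSimplices k = length (filter (λ σ → T? (simplex σ ∧ (∣ σ ∣ ≡ᵇ k))) (allSubsets n))
    where
      open import Relation.Nullary.Decidable using (Dec; yes; no)
      T? : (b : Bool) → Dec (T b)
      T? true = yes _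
      T? false = no (λ ())

  LinkVertex : Fin n → Fin n → Set
  LinkVertex v u = Adjacent D v u

  linkEdgeB : Fin n → Fin n → Fin n → Bool
  linkEdgeB v a b = not ⌊ a ≟F b ⌋ ∧ not ⌊ a ≟F v ⌋ ∧ not ⌊ b ≟F v ⌋ ∧ simplex (tri D v a b)

  linkDegree : Fin n → Fin n → ℕ
  linkDegree v u = length (filter (λ b → T? (linkEdgeB v u b)) (allFin n))
    where
      open import Relation.Nullary.Decidable using (Dec; yes; no)
      T? : (b : Bool) → Dec (T b)
      T? true = yes _
      T? false = no (λ ())

  data LinkReach (v : Fin n) : Fin n → Fin n → Set where
    here : ∀ {a} → LinkReach v a a
    step : ∀ {a b c} → T (linkEdgeB v a b) → LinkReach v b c → LinkReach v a c

  data Reach : Fin n → Fin n → Set where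
    here : ∀ {a} → Reach a a
    step : ∀ {a b c} → Adjacent D a b → Reach b c → Reach a c

  IsDisc : Set
  IsDisc =
      (∀ σ → IsSimplex D σ → ∣ σ ∣ ≤ 3)
    × (∀ a b → Reach a b)
    × (∀ v u → LinkVertex v u → 1 ≤ linkDegree v u × linkDegree v u ≤ 2)
    × (∀ v a b → LinkVertex v a → LinkVertex v b → LinkReach v a b)
    × (∃ λ v → ∃ λ u → LinkVertex v u × linkDegree v u ≡ 1)
    × (numSimplices 1 + numSimplices 3 ≡ numSimplices 2 + 1)

-- A simplex shared by two wheels lies in both boundaries unless it contains the centre of one
-- of them, say of W, which is then a vertex of the other wheel U. Vertex links in a disc are
-- paths or cycles, so the rim of a wheel is the whole link of its centre: if W and U have the
-- same centre they have the same simplices. Otherwise W's centre is a rim vertex of U, so U's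
-- centre is a neighbour of W's centre and hence lies on W's rim, and the two neighbours of W's
-- centre on U's rim are the two neighbours of U's centre on W's rim. Suitably indexed, U and W
-- then form a dwheel with boundary length at most 7 whose wheels are full (a flag disc has no
-- 3-wheels), so by 7-locatedness some vertex v has the whole dwheel in its link, and v together
-- with a triangle of U would span a 3-simplex.

{-# OPTIONS --safe #-}
module Submission where

open import Defs
open import Data.Bool using (T)
open import Data.Empty using (⊥; ⊥-elim)
open import Data.Fin using (Fin; zero; suc; toℕ; fromℕ; inject₁; opposite) renaming (_≟_ to _≟F_)
open import Data.Fin.Properties using (toℕ-injective; toℕ-fromℕ; toℕ-inject₁; toℕ≤pred[n]; opposite-involutive; any?)
open import Data.Fin.Relation.Unary.Top using (view; ‵fromℕ; ‵inject₁)
open import Data.Fin.Subset using (Subset; ⁅_⁆; _∪_; _∈_; _∉_; _⊆_; ∣_∣; Nonempty)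
open import Data.Fin.Subset.Properties using (x∈⁅x⁆; x∈⁅y⁆⇒x≡y; x≢y⇒x∉⁅y⁆; x∈p∪q⁺; x∈p∪q⁻; q⊆p∪q; ∪-comm; ∉⊥; ⊆-antisym; p⊂q⇒∣p∣<∣q∣; ∣⁅x⁆∣≡1; _∈?_)
open import Data.List using (length)
open import Data.List.Membership.Propositional using () renaming (_∈_ to _∈ₗ_)
open import Data.List.Membership.Propositional.Properties using (∈-length; ∈-filter⁺; ∈-allFin)
open import Data.List.Relation.Unary.Any using (here; there)
open import Data.Nat using (ℕ; zero; suc; _+_; _∸_; _≤_; _<_; z≤n; s≤s; s≤s⁻¹)
open import Data.Nat.Properties using (≤-refl; <⇒≤; <⇒≢; ≤⇒≯; +-comm; +-mono-≤; m∸n+n≡m; m≤n⇒m≤1+n; module ≤-Reasoning)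
open import Data.Product using (∃; _×_; _,_; proj₁; proj₂; map₂)
open import Data.Sum using (_⊎_; inj₁; inj₂; [_,_]′) renaming (map to ⊎-map)
open import Function.Base using (_∘_; id)
open import Function.Bundles using (_⇔_; mk⇔)
open import Function.Definitions using (Injective)
open import Function.Properties.Equivalence using () renaming (sym to ⇔-sym)
open import Relation.Nullary using (¬_; yes; no; contradiction)
open import Relation.Binary.PropositionalEquality using (_≡_; _≢_; refl; sym; trans; cong; cong₂; cong-app; subst₂; subst; module ≡-Reasoning)

private
  variable
    n : ℕ
    a b c v x y z : Fin n
    σ : Subset n

-- Definitionally Defs' edge D and tri D, but independent of D, so that D can stay implicit.

pair : Fin n → Fin n → Subset n
pair a b = ⁅ a ⁆ ∪ ⁅ b ⁆

triple : Fin n → Fin n → Fin n → Subset n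
triple a b c = ⁅ a ⁆ ∪ pair b c

∈-pairˡ : a ∈ pair a b
∈-pairˡ {a = a} = x∈p∪q⁺ (inj₁ (x∈⁅x⁆ a))

∈-pairʳ : b ∈ pair a b
∈-pairʳ {b = b} = x∈p∪q⁺ (inj₂ (x∈⁅x⁆ b))

∈-triple₁ : a ∈ triple a b c
∈-triple₁ {a = a} = x∈p∪q⁺ (inj₁ (x∈⁅x⁆ a))

∈-triple₂ : b ∈ triple a b c
∈-triple₂ = x∈p∪q⁺ (inj₂ ∈-pairˡ)

∈-triple₃ : c ∈ triple a b c
∈-triple₃ = x∈p∪q⁺ (inj₂ ∈-pairʳ)

∈-pair⁻ : x ∈ pair a b → x ≡ a ⊎ x ≡ b
∈-pair⁻ {a = a} {b = b} = ⊎-map (x∈⁅y⁆⇒x≡y a) (x∈⁅y⁆⇒x≡y b) ∘ x∈p∪q⁻ ⁅ a ⁆ ⁅ b ⁆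

∈-triple⁻ : x ∈ triple a b c → x ≡ a ⊎ x ≡ b ⊎ x ≡ c
∈-triple⁻ {a = a} {b = b} {c = c} = ⊎-map (x∈⁅y⁆⇒x≡y a) ∈-pair⁻ ∘ x∈p∪q⁻ ⁅ a ⁆ (pair b c)

⁅⁆⊆ : ∀ {p : Subset n} → a ∈ p → ⁅ a ⁆ ⊆ p
⁅⁆⊆ {a = a} a∈p x∈⁅a⁆ = subst (_∈ _) (sym (x∈⁅y⁆⇒x≡y a x∈⁅a⁆)) a∈p

pair⊆ : ∀ {p : Subset n} → a ∈ p → b ∈ p → pair a b ⊆ p
pair⊆ a∈p b∈p = [ ⁅⁆⊆ a∈p , ⁅⁆⊆ b∈p ]′ ∘ x∈p∪q⁻ _ _

triple⊆ : ∀ {p : Subset n} → a ∈ p → b ∈ p → c ∈ p → triple a b c ⊆ p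
triple⊆ a∈p b∈p c∈p = [ ⁅⁆⊆ a∈p , pair⊆ b∈p c∈p ]′ ∘ x∈p∪q⁻ _ _

⊆-triple-cases : ∀ {p : Subset n} → σ ⊆ triple a b c →
                 (a ∈ σ → a ∈ p) → (b ∈ σ → b ∈ p) → (c ∈ σ → c ∈ p) → σ ⊆ p
⊆-triple-cases σ⊆abc at-a at-b at-c x∈σ with ∈-triple⁻ (σ⊆abc x∈σ)
... | inj₁ refl        = at-a x∈σ
... | inj₂ (inj₁ refl) = at-b x∈σ
... | inj₂ (inj₂ refl) = at-c x∈σ

pair-comm : pair a b ≡ pair b a
pair-comm {a = a} {b = b} = ∪-comm ⁅ a ⁆ ⁅ b ⁆

∣p∣<∣⁅x⁆∪p∣ : ∀ {p : Subset n} → x ∉ p → ∣ p ∣ < ∣ ⁅ x ⁆ ∪ p ∣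
∣p∣<∣⁅x⁆∪p∣ {x = x} {p = p} x∉p = p⊂q⇒∣p∣<∣q∣ (q⊆p∪q ⁅ x ⁆ p , x , x∈p∪q⁺ (inj₁ (x∈⁅x⁆ x)) , x∉p)

4≤∣⁅v⁆∪triple∣ : a ≢ b → a ≢ c → b ≢ c → v ∉ triple a b c → 4 ≤ ∣ ⁅ v ⁆ ∪ triple a b c ∣
4≤∣⁅v⁆∪triple∣ {a = a} {b = b} {c = c} {v = v} a≢b a≢c b≢c v∉abc = begin
  4                            ≡⟨ cong (3 +_) (∣⁅x⁆∣≡1 c) ⟨
  3 + ∣ ⁅ c ⁆ ∣                ≤⟨ s≤s (s≤s (∣p∣<∣⁅x⁆∪p∣ (x≢y⇒x∉⁅y⁆ b≢c))) ⟩
  2 + ∣ pair b c ∣             ≤⟨ s≤s (∣p∣<∣⁅x⁆∪p∣ ([ a≢b , a≢c ]′ ∘ ∈-pair⁻)) ⟩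
  1 + ∣ triple a b c ∣         ≤⟨ ∣p∣<∣⁅x⁆∪p∣ v∉abc ⟩
  ∣ ⁅ v ⁆ ∪ triple a b c ∣     ∎
  where open ≤-Reasoning

module _ {A : Set} where

  2≤length : ∀ {x y : A} {xs} → x ∈ₗ xs → y ∈ₗ xs → x ≢ y → 2 ≤ length xs
  2≤length (here refl)  (here refl)  x≢y = contradiction refl x≢y
  2≤length (here refl)  (there y∈xs) _   = s≤s (∈-length y∈xs)
  2≤length (there x∈xs) (here refl)  _   = s≤s (∈-length x∈xs)
  2≤length (there x∈xs) (there y∈xs) x≢y = m≤n⇒m≤1+n (2≤length x∈xs y∈xs x≢y)

  3≤length : ∀ {x y z : A} {xs} → x ∈ₗ xs → y ∈ₗ xs → z ∈ₗ xs → x ≢ y → x ≢ z → y ≢ z → 3 ≤ length xs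
  3≤length (here refl)  (here refl)  _            x≢y _   _   = contradiction refl x≢y
  3≤length (here refl)  (there _)    (here refl)  _   x≢z _   = contradiction refl x≢z
  3≤length (here refl)  (there y∈xs) (there z∈xs) _   _   y≢z = s≤s (2≤length y∈xs z∈xs y≢z)
  3≤length (there _)    (here refl)  (here refl)  _   _   y≢z = contradiction refl y≢z
  3≤length (there x∈xs) (here refl)  (there z∈xs) _   x≢z _   = s≤s (2≤length x∈xs z∈xs x≢z)
  3≤length (there x∈xs) (there y∈xs) (here refl)  x≢y _   _   = s≤s (2≤length x∈xs y∈xs x≢y)
  3≤length (there x∈xs) (there y∈xs) (there z∈xs) x≢y x≢z y≢z = m≤n⇒m≤1+n (3≤length x∈xs y∈xs z∈xs x≢y x≢z y≢z)

next-fromℕ : ∀ m → next (fromℕ m) ≡ zero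
next-fromℕ zero = refl
next-fromℕ (suc m) rewrite next-fromℕ m = refl

next-inject₁ : ∀ {m} (i : Fin m) → next (inject₁ i) ≡ suc i
next-inject₁ {suc m} zero = refl
next-inject₁ {suc m} (suc i) rewrite next-inject₁ i = refl

toℕ-next : ∀ {m} (i : Fin (suc m)) → toℕ i < m → toℕ (next i) ≡ suc (toℕ i)
toℕ-next {m} i i<m with view i
... | ‵fromℕ = contradiction (toℕ-fromℕ m) (<⇒≢ i<m)
... | ‵inject₁ j = begin
  toℕ (next (inject₁ j)) ≡⟨ cong toℕ (next-inject₁ j) ⟩
  suc (toℕ j)            ≡⟨ cong suc (toℕ-inject₁ j) ⟨
  suc (toℕ (inject₁ j))  ∎
  where open ≡-Reasoning

opposite-fromℕ : ∀ m → opposite (fromℕ m) ≡ zero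
opposite-fromℕ zero = refl
opposite-fromℕ (suc m) = cong inject₁ (opposite-fromℕ m)

opposite-inject₁ : ∀ {m} (i : Fin m) → opposite (inject₁ i) ≡ suc (opposite i)
opposite-inject₁ {suc m} zero = refl
opposite-inject₁ (suc i) = cong inject₁ (opposite-inject₁ i)

next-opposite-next : ∀ {m} (i : Fin (suc m)) → next (opposite (next i)) ≡ opposite i
next-opposite-next {m} i with view i
... | ‵fromℕ = begin
  next (opposite (next (fromℕ m))) ≡⟨ cong (next ∘ opposite) (next-fromℕ m) ⟩
  next (fromℕ m)                   ≡⟨ next-fromℕ m ⟩
  zero                             ≡⟨ opposite-fromℕ m ⟨
  opposite (fromℕ m)               ∎
  where open ≡-Reasoning
... | ‵inject₁ j = begin
  next (opposite (next (inject₁ j))) ≡⟨ cong (next ∘ opposite) (next-inject₁ j) ⟩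
  next (inject₁ (opposite j))        ≡⟨ next-inject₁ (opposite j) ⟩
  suc (opposite j)                   ≡⟨ opposite-inject₁ j ⟨
  opposite (inject₁ j)               ∎
  where open ≡-Reasoning

IsRotation : ∀ {m} → (Fin (suc m) → Fin (suc m)) → Set
IsRotation τ = ∀ k → τ (next k) ≡ next (τ k)

IsReflection : ∀ {m} → (Fin (suc m) → Fin (suc m)) → Set
IsReflection τ = ∀ k → next (τ (next k)) ≡ τ k

record Symmetry (m : ℕ) : Set where
  field
    act         : Fin (suc m) → Fin (suc m)
    injective   : Injective _≡_ _≡_ act
    orientation : IsRotation act ⊎ IsReflection act

module _ {m : ℕ} where
  open import Function.Endo.Propositional (Fin (suc m)) using (_^_; ^-homo)
  open ≡-Reasoning

  ^-comm : ∀ a b x → (next ^ a) ((next ^ b) x) ≡ (next ^ b) ((next ^ a) x)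
  ^-comm a b x = begin
    (next ^ a) ((next ^ b) x) ≡⟨ cong-app (^-homo next a b) x ⟨
    (next ^ (a + b)) x        ≡⟨ cong (λ k → (next ^ k) x) (+-comm a b) ⟩
    (next ^ (b + a)) x        ≡⟨ cong-app (^-homo next b a) x ⟩
    (next ^ b) ((next ^ a) x) ∎

  toℕ-next^-zero : ∀ k → k ≤ m → toℕ ((next ^ k) zero) ≡ k
  toℕ-next^-zero zero    _   = refl
  toℕ-next^-zero (suc k) k<m = trans (toℕ-next _ (subst (_< m) (sym ih) k<m)) (cong suc ih)
    where ih = toℕ-next^-zero k (<⇒≤ k<m)

  next^toℕ : ∀ i → (next ^ toℕ i) zero ≡ i
  next^toℕ i = toℕ-injective (toℕ-next^-zero (toℕ i) (toℕ≤pred[n] i))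

  next^-period : ∀ x → (next ^ suc m) x ≡ x
  next^-period x = begin
    (next ^ suc m) x                      ≡⟨ cong (next ^ suc m) (next^toℕ x) ⟨
    (next ^ suc m) ((next ^ toℕ x) zero)  ≡⟨ ^-comm (suc m) (toℕ x) zero ⟩
    (next ^ toℕ x) (next ((next ^ m) zero)) ≡⟨ cong (λ y → (next ^ toℕ x) (next y)) last ⟩
    (next ^ toℕ x) (next (fromℕ m))       ≡⟨ cong (next ^ toℕ x) (next-fromℕ m) ⟩
    (next ^ toℕ x) zero                   ≡⟨ next^toℕ x ⟩
    x                                     ∎
    where
    last : (next ^ m) zero ≡ fromℕ m
    last = toℕ-injective (trans (toℕ-next^-zero m ≤-refl) (sym (toℕ-fromℕ m)))

  prev : Fin (suc m) → Fin (suc m)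
  prev = next ^ m

  next-prev : ∀ x → next (prev x) ≡ x
  next-prev = next^-period

  prev-next : ∀ x → prev (next x) ≡ x
  prev-next x = trans (^-comm m 1 x) (next^-period x)

  next-injective : Injective _≡_ _≡_ next
  next-injective {x} {y} e = trans (sym (prev-next x)) (trans (cong prev e) (prev-next y))

  next^-injective : ∀ k → Injective _≡_ _≡_ (next ^ k)
  next^-injective zero    e = e
  next^-injective (suc k) e = next^-injective k (next-injective e)

  next^-fixed-point-free : ∀ {k} x → 0 < k → k ≤ m → (next ^ k) x ≢ x
  next^-fixed-point-free {k} x 0<k k≤m fixed = <⇒≢ 0<k (sym (begin
    k                        ≡⟨ toℕ-next^-zero k k≤m ⟨
    toℕ ((next ^ k) zero)    ≡⟨ cong toℕ (next^-injective (toℕ x) fixes-zero) ⟩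
    toℕ (zero {m})           ∎))
    where
    fixes-zero : (next ^ toℕ x) ((next ^ k) zero) ≡ (next ^ toℕ x) zero
    fixes-zero = begin
      (next ^ toℕ x) ((next ^ k) zero) ≡⟨ ^-comm (toℕ x) k zero ⟩
      (next ^ k) ((next ^ toℕ x) zero) ≡⟨ cong (next ^ k) (next^toℕ x) ⟩
      (next ^ k) x                     ≡⟨ fixed ⟩
      x                                ≡⟨ next^toℕ x ⟨
      (next ^ toℕ x) zero              ∎

  next^-transitive : ∀ x y → ∃ λ k → (next ^ k) x ≡ y
  next^-transitive x y = toℕ y + (suc m ∸ toℕ x) , (begin
    (next ^ (toℕ y + (suc m ∸ toℕ x))) x       ≡⟨ cong-app (^-homo next (toℕ y) _) x ⟩
    (next ^ toℕ y) ((next ^ (suc m ∸ toℕ x)) x) ≡⟨ cong (next ^ toℕ y) to-zero ⟩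
    (next ^ toℕ y) zero                         ≡⟨ next^toℕ y ⟩
    y                                           ∎)
    where
    to-zero : (next ^ (suc m ∸ toℕ x)) x ≡ zero
    to-zero = begin
      (next ^ (suc m ∸ toℕ x)) x                     ≡⟨ cong (next ^ (suc m ∸ toℕ x)) (next^toℕ x) ⟨
      (next ^ (suc m ∸ toℕ x)) ((next ^ toℕ x) zero) ≡⟨ cong-app (^-homo next (suc m ∸ toℕ x) (toℕ x)) zero ⟨
      (next ^ (suc m ∸ toℕ x + toℕ x)) zero          ≡⟨ cong (λ k → (next ^ k) zero) (m∸n+n≡m (m≤n⇒m≤1+n (toℕ≤pred[n] x))) ⟩
      (next ^ suc m) zero                            ≡⟨ next^-period zero ⟩
      zero                                           ∎

  rotation-to : ∀ x y → ∃ λ (τ : Symmetry m) → Symmetry.act τ x ≡ y × IsRotation (Symmetry.act τ)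
  rotation-to x y with next^-transitive x y
  ... | k , τx≡y = record { act = next ^ k ; injective = next^-injective k ; orientation = inj₁ rotates }
                 , τx≡y , rotates
    where
    rotates : IsRotation (next ^ k)
    rotates i = ^-comm k 1 i

  reflection-to : ∀ x y → ∃ λ (τ : Symmetry m) → Symmetry.act τ x ≡ y × IsReflection (Symmetry.act τ)
  reflection-to x y with next^-transitive (opposite x) y
  ... | k , τx≡y = record { act = act ; injective = injective ; orientation = inj₂ reflects }
                 , τx≡y , reflects
    where
    act : Fin (suc m) → Fin (suc m)
    act i = (next ^ k) (opposite i)
    injective : Injective _≡_ _≡_ act
    injective {i} {j} e = begin
      i                       ≡⟨ opposite-involutive i ⟨
      opposite (opposite i)   ≡⟨ cong opposite (next^-injective k e) ⟩
      opposite (opposite j)   ≡⟨ opposite-involutive j ⟩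
      j                       ∎
    reflects : IsReflection act
    reflects i = trans (^-comm 1 k (opposite (next i))) (cong (next ^ k) (next-opposite-next i))

  next≢id : 0 < m → ∀ x → next x ≢ x
  next≢id 0<m x = next^-fixed-point-free {1} x (s≤s z≤n) 0<m

  prev≢id : 0 < m → ∀ x → prev x ≢ x
  prev≢id 0<m x e = next≢id 0<m x (trans (cong next (sym e)) (next-prev x))

  next≢prev : 1 < m → ∀ x → next x ≢ prev x
  next≢prev 1<m x e = next^-fixed-point-free {2} x (s≤s z≤n) 1<m (trans (cong next e) (next-prev x))

  prev≢next² : 2 < m → ∀ x → prev x ≢ next (next x)
  prev≢next² 2<m x e = next^-fixed-point-free {3} x (s≤s z≤n) 2<m (sym (trans (sym (next-prev x)) (cong next e)))

module _ {e : ℕ} where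
  open Symmetry
  open ≡-Reasoning

  last penult : Fin (3 + e)
  last   = fromℕ (2 + e)
  penult = inject₁ (fromℕ (1 + e))

  next-penult : next penult ≡ last
  next-penult = next-inject₁ (fromℕ (1 + e))

  rotation-around : ∀ i → ∃ λ (τ : Symmetry (2 + e)) →
                    act τ last ≡ i × act τ zero ≡ next i × act τ penult ≡ prev i
  rotation-around i with rotation-to last i
  ... | τ , τ-last , rotates = τ , τ-last , at-zero , at-penult
    where
    at-zero = begin
      act τ zero        ≡⟨ cong (act τ) (next-fromℕ (2 + e)) ⟨
      act τ (next last) ≡⟨ rotates last ⟩
      next (act τ last) ≡⟨ cong next τ-last ⟩
      next i            ∎
    at-penult = begin
      act τ penult               ≡⟨ prev-next (act τ penult) ⟨
      prev (next (act τ penult)) ≡⟨ cong prev (rotates penult) ⟨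
      prev (act τ (next penult)) ≡⟨ cong (prev ∘ act τ) next-penult ⟩
      prev (act τ last)          ≡⟨ cong prev τ-last ⟩
      prev i                     ∎

  reflection-around : ∀ i → ∃ λ (τ : Symmetry (2 + e)) →
                      act τ last ≡ i × act τ zero ≡ prev i × act τ penult ≡ next i
  reflection-around i with reflection-to last i
  ... | τ , τ-last , reflects = τ , τ-last , at-zero , at-penult
    where
    at-zero = begin
      act τ zero                      ≡⟨ prev-next (act τ zero) ⟨
      prev (next (act τ zero))        ≡⟨ cong (prev ∘ next ∘ act τ) (next-fromℕ (2 + e)) ⟨
      prev (next (act τ (next last))) ≡⟨ cong prev (reflects last) ⟩
      prev (act τ last)               ≡⟨ cong prev τ-last ⟩
      prev i                          ∎
    at-penult = begin
      act τ penult               ≡⟨ reflects penult ⟨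
      next (act τ (next penult)) ≡⟨ cong (next ∘ act τ) next-penult ⟩
      next (act τ last)          ≡⟨ cong next τ-last ⟩
      next i                     ∎

  rotation-through : ∀ j → ∃ λ (τ : Symmetry (2 + e)) →
                     act τ zero ≡ prev j × act τ (suc zero) ≡ j × act τ (suc (suc zero)) ≡ next j
  rotation-through j with rotation-to (suc zero) j
  ... | τ , τ-one , rotates = τ , at-zero , τ-one , trans (rotates (suc zero)) (cong next τ-one)
    where
    at-zero = begin
      act τ zero               ≡⟨ prev-next (act τ zero) ⟨
      prev (next (act τ zero)) ≡⟨ cong prev (rotates zero) ⟨
      prev (act τ (suc zero))  ≡⟨ cong prev τ-one ⟩
      prev j                   ∎

Fin3-distinct⇒adjacent : ∀ (k l : Fin 3) → k ≢ l → l ≡ next k ⊎ k ≡ next l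
Fin3-distinct⇒adjacent zero             zero             k≢l = contradiction refl k≢l
Fin3-distinct⇒adjacent zero             (suc zero)       _   = inj₁ refl
Fin3-distinct⇒adjacent zero             (suc (suc zero)) _   = inj₂ refl
Fin3-distinct⇒adjacent (suc zero)       zero             _   = inj₂ refl
Fin3-distinct⇒adjacent (suc zero)       (suc zero)       k≢l = contradiction refl k≢l
Fin3-distinct⇒adjacent (suc zero)       (suc (suc zero)) _   = inj₁ refl
Fin3-distinct⇒adjacent (suc (suc zero)) zero             _   = inj₁ refl
Fin3-distinct⇒adjacent (suc (suc zero)) (suc zero)       _   = inj₂ refl
Fin3-distinct⇒adjacent (suc (suc zero)) (suc (suc zero)) k≢l = contradiction refl k≢l

pattern centre-face e         = inj₁ e
pattern vertex-face i e       = inj₂ (i , inj₁ e)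
pattern spoke-face i e        = inj₂ (i , inj₂ (inj₁ e))
pattern rim-edge-face i e     = inj₂ (i , inj₂ (inj₂ (inj₁ e)))
pattern triangle-face i e     = inj₂ (i , inj₂ (inj₂ (inj₂ e)))
pattern boundary-vertex i e   = (i , inj₁ e)
pattern boundary-edge i e     = (i , inj₂ e)

module _ (D : Complex n) where
  open Complex D

  Dim≤2 : Set
  Dim≤2 = ∀ σ → IsSimplex D σ → ∣ σ ∣ ≤ 3

  LinkDegree≤2 : Set
  LinkDegree≤2 = ∀ v u → LinkVertex D v u → linkDegree D v u ≤ 2

  ConnectedLinks : Set
  ConnectedLinks = ∀ v a b → LinkVertex D v a → LinkVertex D v b → LinkReach D v a b

  edge-of : IsSimplex D σ → a ∈ σ → b ∈ σ → IsSimplex D (pair a b)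
  edge-of {σ = σ} {a = a} σ-simplex a∈σ b∈σ = downward σ _ σ-simplex (pair⊆ a∈σ b∈σ) (a , ∈-pairˡ)

  triangle-of : IsSimplex D σ → a ∈ σ → b ∈ σ → c ∈ σ → IsSimplex D (triple a b c)
  triangle-of {σ = σ} {a = a} σ-simplex a∈σ b∈σ c∈σ =
    downward σ _ σ-simplex (triple⊆ a∈σ b∈σ c∈σ) (a , ∈-triple₁)

  flag-triangle : IsFlag D → IsSimplex D (pair a b) → IsSimplex D (pair a c) → IsSimplex D (pair b c) →
                  IsSimplex D (triple a b c)
  flag-triangle {a = a} {b = b} {c = c} flag ab ac bc = flag _ (a , ∈-triple₁) edges
    where
    flip : IsSimplex D (pair x y) → IsSimplex D (pair y x)
    flip xy = edge-of xy ∈-pairʳ ∈-pairˡ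

    edges : ∀ x y → x ∈ triple a b c → y ∈ triple a b c → x ≢ y → IsSimplex D (pair x y)
    edges x y x∈ y∈ x≢y with ∈-triple⁻ x∈ | ∈-triple⁻ y∈
    ... | inj₁ refl        | inj₁ refl        = contradiction refl x≢y
    ... | inj₁ refl        | inj₂ (inj₁ refl) = ab
    ... | inj₁ refl        | inj₂ (inj₂ refl) = ac
    ... | inj₂ (inj₁ refl) | inj₁ refl        = flip ab
    ... | inj₂ (inj₁ refl) | inj₂ (inj₁ refl) = contradiction refl x≢y
    ... | inj₂ (inj₁ refl) | inj₂ (inj₂ refl) = bc
    ... | inj₂ (inj₂ refl) | inj₁ refl        = flip ac
    ... | inj₂ (inj₂ refl) | inj₂ (inj₁ refl) = flip bc
    ... | inj₂ (inj₂ refl) | inj₂ (inj₂ refl) = contradiction refl x≢y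

  triangle∉link : Dim≤2 → a ≢ b → a ≢ c → b ≢ c → ¬ InLink D v (triple a b c)
  triangle∉link dim a≢b a≢c b≢c (_ , v∉abc , simplex) =
    ≤⇒≯ (dim _ simplex) (4≤∣⁅v⁆∪triple∣ a≢b a≢c b≢c v∉abc)

  linkEdge⁺ : a ≢ b → a ≢ v → b ≢ v → IsSimplex D (triple v a b) → T (linkEdgeB D v a b)
  linkEdge⁺ {a = a} {b = b} {v = v} a≢b a≢v b≢v vab with a ≟F b | a ≟F v | b ≟F v
  ... | yes a≡b | _       | _       = contradiction a≡b a≢b
  ... | no _    | yes a≡v | _       = contradiction a≡v a≢v
  ... | no _    | no _    | yes b≡v = contradiction b≡v b≢v
  ... | no _    | no _    | no _    = vab

  linkEdge⁻ : T (linkEdgeB D v a b) → a ≢ b × a ≢ v × b ≢ v × IsSimplex D (triple v a b)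
  linkEdge⁻ {v = v} {a = a} {b = b} e with a ≟F b | a ≟F v | b ≟F v
  ... | no a≢b | no a≢v | no b≢v = a≢b , a≢v , b≢v , e

  3≤linkDegree : T (linkEdgeB D v a x) → T (linkEdgeB D v a y) → T (linkEdgeB D v a z) →
                 x ≢ y → x ≢ z → y ≢ z → 3 ≤ linkDegree D v a
  3≤linkDegree ax ay az = 3≤length (∈-filter⁺ _ (∈-allFin _) ax) (∈-filter⁺ _ (∈-allFin _) ay) (∈-filter⁺ _ (∈-allFin _) az)

  module _ (W : Wheel D) where
    open Wheel W

    VertexOf : Fin n → Set
    VertexOf x = x ≡ center ⊎ ∃ λ i → x ≡ rim i

    rim-next≢ : ∀ i → rim (next i) ≢ rim i
    rim-next≢ i = next≢id (s≤s z≤n) i ∘ rim-inj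

    rim-prev≢ : ∀ i → rim (prev i) ≢ rim i
    rim-prev≢ i = prev≢id (s≤s z≤n) i ∘ rim-inj

    spoke : ∀ i → IsSimplex D (pair center (rim i))
    spoke i = edge-of (triangle i) ∈-triple₁ ∈-triple₂

    centre-adjacent : ∀ i → Adjacent D center (rim i)
    centre-adjacent i = center∉ i , spoke i

    triangle-before : ∀ i → IsSimplex D (triple center (rim i) (rim (prev i)))
    triangle-before i = triangle-of (triangle (prev i)) ∈-triple₁ rim-i ∈-triple₂
      where
      rim-i : rim i ∈ triple center (rim (prev i)) (rim (next (prev i)))
      rim-i = subst (λ j → rim j ∈ triple center (rim (prev i)) (rim (next (prev i)))) (next-prev i) ∈-triple₃

    wheel-vertex : InWheel W σ → x ∈ σ → VertexOf x
    wheel-vertex (centre-face refl)    x∈ = inj₁ (x∈⁅y⁆⇒x≡y _ x∈)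
    wheel-vertex (vertex-face i refl)  x∈ = inj₂ (i , x∈⁅y⁆⇒x≡y _ x∈)
    wheel-vertex (spoke-face i refl)   x∈ = ⊎-map id (i ,_) (∈-pair⁻ x∈)
    wheel-vertex (rim-edge-face i refl) x∈ = inj₂ ([ (i ,_) , (next i ,_) ]′ (∈-pair⁻ x∈))
    wheel-vertex (triangle-face i refl) x∈ = ⊎-map id [ (i ,_) , (next i ,_) ]′ (∈-triple⁻ x∈)

    boundary-or-centre : InWheel W σ → InBoundary W σ ⊎ center ∈ σ
    boundary-or-centre (centre-face refl)      = inj₂ (x∈⁅x⁆ center)
    boundary-or-centre (vertex-face i e)       = inj₁ (boundary-vertex i e)
    boundary-or-centre (spoke-face i refl)     = inj₂ ∈-pairˡ
    boundary-or-centre (rim-edge-face i e)     = inj₁ (boundary-edge i e)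
    boundary-or-centre (triangle-face i refl)  = inj₂ ∈-triple₁

    face-of-triangle : ∀ i → Nonempty σ → σ ⊆ triple center (rim i) (rim (next i)) → InWheel W σ
    face-of-triangle {σ = σ} i (x , x∈σ) σ⊆ with center ∈? σ | rim i ∈? σ | rim (next i) ∈? σ
    ... | yes c∈ | yes a∈ | yes b∈ = triangle-face i (⊆-antisym σ⊆ (triple⊆ c∈ a∈ b∈))
    ... | yes c∈ | yes a∈ | no b∉  = spoke-face i (⊆-antisym
      (⊆-triple-cases σ⊆ (λ _ → ∈-pairˡ) (λ _ → ∈-pairʳ) (⊥-elim ∘ b∉)) (pair⊆ c∈ a∈))
    ... | yes c∈ | no a∉  | yes b∈ = spoke-face (next i) (⊆-antisym
      (⊆-triple-cases σ⊆ (λ _ → ∈-pairˡ) (⊥-elim ∘ a∉) (λ _ → ∈-pairʳ)) (pair⊆ c∈ b∈))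
    ... | yes c∈ | no a∉  | no b∉  = centre-face (⊆-antisym
      (⊆-triple-cases σ⊆ (λ _ → x∈⁅x⁆ center) (⊥-elim ∘ a∉) (⊥-elim ∘ b∉)) (⁅⁆⊆ c∈))
    ... | no c∉  | yes a∈ | yes b∈ = rim-edge-face i (⊆-antisym
      (⊆-triple-cases σ⊆ (⊥-elim ∘ c∉) (λ _ → ∈-pairˡ) (λ _ → ∈-pairʳ)) (pair⊆ a∈ b∈))
    ... | no c∉  | yes a∈ | no b∉  = vertex-face i (⊆-antisym
      (⊆-triple-cases σ⊆ (⊥-elim ∘ c∉) (λ _ → x∈⁅x⁆ (rim i)) (⊥-elim ∘ b∉)) (⁅⁆⊆ a∈))
    ... | no c∉  | no a∉  | yes b∈ = vertex-face (next i) (⊆-antisym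
      (⊆-triple-cases σ⊆ (⊥-elim ∘ c∉) (⊥-elim ∘ a∉) (λ _ → x∈⁅x⁆ (rim (next i)))) (⁅⁆⊆ b∈))
    ... | no c∉  | no a∉  | no b∉  =
      ⊥-elim (∉⊥ (⊆-triple-cases σ⊆ (⊥-elim ∘ c∉) (⊥-elim ∘ a∉) (⊥-elim ∘ b∉) x∈σ))

    reindex : Symmetry (2 + ext) → Wheel D
    reindex τ = record
      { ext      = ext
      ; center   = center
      ; rim      = rim ∘ act
      ; rim-inj  = injective ∘ rim-inj
      ; center∉  = center∉ ∘ act
      ; triangle = reindexed-triangle orientation
      }
      where
      open Symmetry τ

      reindexed-triangle : IsRotation act ⊎ IsReflection act →
                           ∀ k → IsSimplex D (triple center (rim (act k)) (rim (act (next k))))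
      reindexed-triangle (inj₁ rotates) k =
        subst (λ j → IsSimplex D (triple center (rim (act k)) (rim j))) (sym (rotates k)) (triangle (act k))
      reindexed-triangle (inj₂ reflects) k =
        subst (λ j → IsSimplex D (triple center (rim j) (rim (act (next k))))) (reflects k)
              (triangle-of (triangle (act (next k))) ∈-triple₁ ∈-triple₃ ∈-triple₂)

  -- In a flag complex the centre and rim of a 3-wheel would span a 3-simplex.
  4≤len : IsFlag D → Dim≤2 → (W : Wheel D) → 4 ≤ Wheel.len W
  4≤len _    _   record { ext = suc _ } = s≤s (s≤s (s≤s (s≤s z≤n)))
  4≤len flag dim W@record { ext = zero ; center = c ; rim = r ; rim-inj = r-inj ; center∉ = c∉ ; triangle = t } =
    ⊥-elim (≤⇒≯ (dim _ (flag _ (c , x∈p∪q⁺ (inj₁ (x∈⁅x⁆ c))) edges))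
                (4≤∣⁅v⁆∪triple∣ ((λ ()) ∘ r-inj) ((λ ()) ∘ r-inj) ((λ ()) ∘ r-inj) c∉rim))
    where
    c∉rim : c ∉ triple (r zero) (r (suc zero)) (r (suc (suc zero)))
    c∉rim = [ c∉ zero , [ c∉ (suc zero) , c∉ (suc (suc zero)) ]′ ]′ ∘ ∈-triple⁻

    vertex : x ∈ ⁅ c ⁆ ∪ triple (r zero) (r (suc zero)) (r (suc (suc zero))) → VertexOf W x
    vertex x∈ with x∈p∪q⁻ ⁅ c ⁆ _ x∈
    ... | inj₁ x∈⁅c⁆ = inj₁ (x∈⁅y⁆⇒x≡y c x∈⁅c⁆)
    ... | inj₂ x∈rim = inj₂ ([ (zero ,_) , [ (suc zero ,_) , (suc (suc zero) ,_) ]′ ]′ (∈-triple⁻ x∈rim))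

    edge-between : VertexOf W x → VertexOf W y → x ≢ y → IsSimplex D (pair x y)
    edge-between (inj₁ refl)       (inj₁ refl)       x≢y = contradiction refl x≢y
    edge-between (inj₁ refl)       (inj₂ (l , refl)) _   = spoke W l
    edge-between (inj₂ (k , refl)) (inj₁ refl)       _   = edge-of (spoke W k) ∈-pairʳ ∈-pairˡ
    edge-between (inj₂ (k , refl)) (inj₂ (l , refl)) x≢y with Fin3-distinct⇒adjacent k l (x≢y ∘ cong r)
    ... | inj₁ refl = edge-of (t k) ∈-triple₂ ∈-triple₃
    ... | inj₂ refl = edge-of (t l) ∈-triple₃ ∈-triple₂

    edges : ∀ x y → x ∈ _ → y ∈ _ → x ≢ y → IsSimplex D (pair x y)
    edges _ _ x∈ y∈ = edge-between (vertex x∈) (vertex y∈)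

  module _ (degree≤2 : LinkDegree≤2) where

    module _ (W : Wheel D) where
      open Wheel W

      rim-neighbour : ∀ i → IsSimplex D (triple center (rim i) b) → b ≢ center → b ≢ rim i →
                      b ≡ rim (next i) ⊎ b ≡ rim (prev i)
      rim-neighbour {b = b} i cib b≢c b≢ri with b ≟F rim (next i) | b ≟F rim (prev i)
      ... | yes b≡next | _          = inj₁ b≡next
      ... | no _       | yes b≡prev = inj₂ b≡prev
      ... | no b≢next  | no b≢prev  =
        ⊥-elim (≤⇒≯ (degree≤2 center (rim i) (centre-adjacent W i)) three-neighbours)
        where
        three-neighbours : 3 ≤ linkDegree D center (rim i)
        three-neighbours = 3≤linkDegree {v = center} {a = rim i}
          (linkEdge⁺ (rim-next≢ W i ∘ sym) (center∉ i ∘ sym) (center∉ (next i) ∘ sym) (triangle i))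
          (linkEdge⁺ (rim-prev≢ W i ∘ sym) (center∉ i ∘ sym) (center∉ (prev i) ∘ sym) (triangle-before W i))
          (linkEdge⁺ (b≢ri ∘ sym) (center∉ i ∘ sym) b≢c cib)
          (next≢prev (s≤s (s≤s z≤n)) i ∘ rim-inj) (b≢next ∘ sym) (b≢prev ∘ sym)

      rim-pair : ∀ i → IsSimplex D (triple center (rim i) b) → b ≢ center → b ≢ rim i →
                 ∃ λ k → pair (rim i) b ≡ pair (rim k) (rim (next k))
      rim-pair i cib b≢c b≢ri with rim-neighbour i cib b≢c b≢ri
      ... | inj₁ refl = i , refl
      ... | inj₂ refl = prev i , (begin
        pair (rim i) (rim (prev i))               ≡⟨ pair-comm ⟩
        pair (rim (prev i)) (rim i)               ≡⟨ cong (pair (rim (prev i)) ∘ rim) (next-prev i) ⟨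
        pair (rim (prev i)) (rim (next (prev i))) ∎)
        where open ≡-Reasoning

    module _ (connected : ConnectedLinks) where

      centre-neighbour-on-rim : (W : Wheel D) → Adjacent D (Wheel.center W) a → ∃ λ i → a ≡ Wheel.rim W i
      centre-neighbour-on-rim W c~a =
        walk (connected center (rim zero) _ (centre-adjacent W zero) c~a) (zero , refl)
        where
        open Wheel W
        walk : LinkReach D center x y → ∃ (λ i → x ≡ rim i) → ∃ (λ i → y ≡ rim i)
        walk here          on-rim     = on-rim
        walk (step e rest) (i , refl) with linkEdge⁻ e
        ... | ri≢b , _ , b≢c , cib =
          walk rest ([ (next i ,_) , (prev i ,_) ]′ (rim-neighbour W i cib b≢c (ri≢b ∘ sym)))

      module _ (W W′ : Wheel D) (same : Wheel.center W′ ≡ Wheel.center W) where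
        open Wheel W
        private module W′ = Wheel W′

        rim′-on-rim : ∀ i → ∃ λ j → W′.rim i ≡ rim j
        rim′-on-rim i =
          centre-neighbour-on-rim W (subst (λ c → Adjacent D c (W′.rim i)) same (centre-adjacent W′ i))

        rim′-triangle : ∀ {i j} → W′.rim i ≡ rim j → IsSimplex D (triple center (rim j) (W′.rim (next i)))
        rim′-triangle {i} r′i≡rj =
          subst₂ (λ c r → IsSimplex D (triple c r (W′.rim (next i)))) same r′i≡rj (W′.triangle i)

        rim′-edge-on-rim : ∀ i → ∃ λ k → pair (W′.rim i) (W′.rim (next i)) ≡ pair (rim k) (rim (next k))
        rim′-edge-on-rim i with rim′-on-rim i
        ... | j , r′i≡rj =
          map₂ (trans (cong (λ r → pair r (W′.rim (next i))) r′i≡rj))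
               (rim-pair W j (rim′-triangle r′i≡rj)
                         (W′.center∉ (next i) ∘ trans same ∘ sym)
                         (rim-next≢ W′ i ∘ (λ e → trans e (sym r′i≡rj))))

        same-centre⇒⊆ : InWheel W′ σ → InWheel W σ
        same-centre⇒⊆ (centre-face e) = centre-face (trans e (cong ⁅_⁆ same))
        same-centre⇒⊆ (vertex-face i e) with rim′-on-rim i
        ... | j , r′i≡rj = vertex-face j (trans e (cong ⁅_⁆ r′i≡rj))
        same-centre⇒⊆ (spoke-face i e) with rim′-on-rim i
        ... | j , r′i≡rj = spoke-face j (trans e (cong₂ pair same r′i≡rj))
        same-centre⇒⊆ (rim-edge-face i e) with rim′-edge-on-rim i
        ... | k , pair≡ = rim-edge-face k (trans e pair≡)
        same-centre⇒⊆ (triangle-face i e) with rim′-edge-on-rim i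
        ... | k , pair≡ = triangle-face k (trans e (cong₂ (λ c p → ⁅ c ⁆ ∪ p) same pair≡))

    module _ (flag : IsFlag D) (W : Wheel D) where
      open Wheel W

      rim-coface-consecutive : ∀ {p q} → IsSimplex D σ → rim p ∈ σ → rim q ∈ σ → p ≢ q →
                               q ≡ next p ⊎ q ≡ prev p
      rim-coface-consecutive {p = p} {q} σs p∈ q∈ p≢q =
        ⊎-map rim-inj rim-inj
          (rim-neighbour W p (flag-triangle flag (spoke W p) (spoke W q) (edge-of σs p∈ q∈))
                         (center∉ q ∘ sym) (p≢q ∘ sym ∘ rim-inj))

      simplex-within-triangle : 4 ≤ len → IsSimplex D σ → (∀ {x} → x ∈ σ → VertexOf W x) →
                                ∃ λ a → σ ⊆ triple center (rim a) (rim (next a))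
      simplex-within-triangle {σ = σ} len≥4 σs on-W with any? (λ i → rim i ∈? σ)
      ... | no no-rim = zero , within
        where
        within : σ ⊆ triple center (rim zero) (rim (next zero))
        within x∈ with on-W x∈
        ... | inj₁ refl       = ∈-triple₁
        ... | inj₂ (i , refl) = contradiction (i , x∈) no-rim
      ... | yes (a , a∈) with rim (next a) ∈? σ
      ...   | yes na∈ = a , within
        where
        within : σ ⊆ triple center (rim a) (rim (next a))
        within x∈ with on-W x∈
        ... | inj₁ refl = ∈-triple₁
        ... | inj₂ (b , refl) with b ≟F a | b ≟F next a
        ...   | yes refl | _        = ∈-triple₂
        ...   | no _     | yes refl = ∈-triple₃
        ...   | no b≢a   | no b≢na
                with rim-coface-consecutive σs a∈ x∈ (b≢a ∘ sym) | rim-coface-consecutive σs na∈ x∈ (b≢na ∘ sym)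
        ...     | inj₁ b≡na | _          = contradiction b≡na b≢na
        ...     | inj₂ b≡pa | inj₁ b≡nna = contradiction (trans (sym b≡pa) b≡nna) (prev≢next² (s≤s⁻¹ len≥4) a)
        ...     | inj₂ _    | inj₂ b≡pna = contradiction (trans b≡pna (prev-next a)) b≢a
      ...   | no na∉ = prev a , within
        where
        within : σ ⊆ triple center (rim (prev a)) (rim (next (prev a)))
        within x∈ with on-W x∈
        ... | inj₁ refl = ∈-triple₁
        ... | inj₂ (b , refl) with b ≟F a
        ...   | yes refl = subst (λ j → rim b ∈ triple center (rim (prev b)) (rim j)) (sym (next-prev b)) ∈-triple₃
        ...   | no b≢a with rim-coface-consecutive σs a∈ x∈ (b≢a ∘ sym)
        ...     | inj₁ refl = contradiction x∈ na∉
        ...     | inj₂ refl = ∈-triple₂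

      wheel-full : 4 ≤ len → IsFull D (InWheel W)
      wheel-full len≥4 σ σs vertices
        with simplex-within-triangle len≥4 σs (λ {x} x∈ → wheel-vertex W (vertices x x∈) (x∈⁅x⁆ x))
      ... | a , σ⊆ = face-of-triangle W a (nonempty σ σs) σ⊆

  module _ {m : ℕ} (located : Located m D) (dim : Dim≤2) where

    no-small-full-dwheel : (W₁ W₂ : Wheel D) → IsDwheel W₁ W₂ → dwheelBoundaryLength W₁ W₂ ≤ m →
                           IsFull D (InWheel W₁) → IsFull D (InWheel W₂) → ⊥
    no-small-full-dwheel W₁ W₂ dwheel bound full₁ full₂ with proj₂ located W₁ W₂ dwheel bound full₁ full₂
    ... | v , in-link = triangle∉link dim (center∉ zero) (center∉ (suc zero)) (rim-next≢ W₁ zero ∘ sym)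
                                      (in-link _ (inj₁ (triangle-face zero refl)))
      where open Wheel W₁

    module _ (degree≤2 : LinkDegree≤2) (connected : ConnectedLinks) where

      -- The rim neighbours p, q of W's centre in U are the rim neighbours of U's centre in W;
      -- reading W from U's centre in the direction that starts with p makes U ∪ W a dwheel.
      centre-not-on-rim : (U W : Wheel D) → 4 ≤ Wheel.len U → 4 ≤ Wheel.len W →
                          dwheelBoundaryLength U W ≤ m → ∀ j → Wheel.center W ≢ Wheel.rim U j
      centre-not-on-rim U W U≥4 W≥4 bound j cW≡rUj =
        orientations (rim-neighbour degree≤2 W i (on-W-triangle (triangle-before U j)) p≢cW p≢rWi)
                     (rim-neighbour degree≤2 W i (on-W-triangle (U.triangle j)) q≢cW q≢rWi)
        where
        module U = Wheel U
        module W = Wheel W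
        open Symmetry

        p q : Fin n
        p = U.rim (prev j)
        q = U.rim (next j)

        cW~cU : Adjacent D W.center U.center
        cW~cU = (λ cW≡cU → U.center∉ j (trans (sym cW≡cU) cW≡rUj))
              , edge-of (U.triangle j) (subst (_∈ triple U.center (U.rim j) q) (sym cW≡rUj) ∈-triple₂) ∈-triple₁

        i : Fin (Wheel.len W)
        i = proj₁ (centre-neighbour-on-rim degree≤2 connected W cW~cU)

        cU≡rWi : U.center ≡ W.rim i
        cU≡rWi = proj₂ (centre-neighbour-on-rim degree≤2 connected W cW~cU)

        on-W-triangle : IsSimplex D (triple U.center (U.rim j) z) →
                        IsSimplex D (triple W.center (W.rim i) z)
        on-W-triangle {z = z} t = subst₂ (λ c r → IsSimplex D (triple c r z)) (sym cW≡rUj) cU≡rWi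
                                         (triangle-of t ∈-triple₂ ∈-triple₁ ∈-triple₃)

        p≢cW : p ≢ W.center
        p≢cW p≡cW = rim-prev≢ U j (trans p≡cW cW≡rUj)
        p≢rWi : p ≢ W.rim i
        p≢rWi p≡rWi = U.center∉ (prev j) (sym (trans p≡rWi (sym cU≡rWi)))
        q≢cW : q ≢ W.center
        q≢cW q≡cW = rim-next≢ U j (trans q≡cW cW≡rUj)
        q≢rWi : q ≢ W.rim i
        q≢rWi q≡rWi = U.center∉ (next j) (sym (trans q≡rWi (sym cU≡rWi)))

        p≢q : p ≢ q
        p≢q = next≢prev (s≤s (s≤s z≤n)) j ∘ sym ∘ U.rim-inj

        dwheel : (τ : Symmetry (2 + W.ext)) → act τ last ≡ i →
                 W.rim (act τ zero) ≡ p → W.rim (act τ penult) ≡ q → ⊥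
        dwheel τ τ-last τ-zero τ-penult with rotation-through j
        ... | ρ , ρ-zero , ρ-one , ρ-two =
          no-small-full-dwheel (reindex U ρ) (reindex W τ) is-dwheel bound
            (wheel-full degree≤2 flag (reindex U ρ) U≥4) (wheel-full degree≤2 flag (reindex W τ) W≥4)
          where
          flag : IsFlag D
          flag = proj₁ located

          is-dwheel : IsDwheel (reindex U ρ) (reindex W τ)
          is-dwheel = trans cU≡rWi (cong W.rim (sym τ-last))
                    , trans cW≡rUj (cong U.rim (sym ρ-one))
                    , trans (cong U.rim ρ-two) (sym τ-penult)
                    , inj₁ (trans (cong U.rim ρ-zero) (sym τ-zero))

        orientations : p ≡ W.rim (next i) ⊎ p ≡ W.rim (prev i) →
                       q ≡ W.rim (next i) ⊎ q ≡ W.rim (prev i) → ⊥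
        orientations (inj₁ p≡next) (inj₁ q≡next) = p≢q (trans p≡next (sym q≡next))
        orientations (inj₂ p≡prev) (inj₂ q≡prev) = p≢q (trans p≡prev (sym q≡prev))
        orientations (inj₁ p≡next) (inj₂ q≡prev) with rotation-around i
        ... | τ , τ-last , τ-zero , τ-penult =
          dwheel τ τ-last (trans (cong W.rim τ-zero) (sym p≡next)) (trans (cong W.rim τ-penult) (sym q≡prev))
        orientations (inj₂ p≡prev) (inj₁ q≡next) with reflection-around i
        ... | τ , τ-last , τ-zero , τ-penult =
          dwheel τ τ-last (trans (cong W.rim τ-zero) (sym p≡prev)) (trans (cong W.rim τ-penult) (sym q≡next))

      shared-centre⇒same-simplices : (W W′ : Wheel D) → 4 ≤ Wheel.len W → 4 ≤ Wheel.len W′ →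
                                     dwheelBoundaryLength W′ W ≤ m → Wheel.center W ∈ σ → InWheel W′ σ →
                                     ∀ τ → InWheel W τ ⇔ InWheel W′ τ
      shared-centre⇒same-simplices W W′ W≥4 W′≥4 bound c∈σ σ∈W′ with wheel-vertex W′ σ∈W′ c∈σ
      ... | inj₁ c≡c′ = λ τ → mk⇔ (same-centre⇒⊆ degree≤2 connected W′ W c≡c′)
                                  (same-centre⇒⊆ degree≤2 connected W W′ (sym c≡c′))
      ... | inj₂ (j , c≡r′j) = ⊥-elim (centre-not-on-rim W′ W W′≥4 W≥4 bound j c≡r′j)

      distinct-wheels-meet-in-boundaries :
        (W₁ W₂ : Wheel D) → 4 ≤ Wheel.len W₁ → 4 ≤ Wheel.len W₂ →
        dwheelBoundaryLength W₁ W₂ ≤ m → dwheelBoundaryLength W₂ W₁ ≤ m →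
        ¬ (∀ τ → InWheel W₁ τ ⇔ InWheel W₂ τ) →
        ∀ σ → InWheel W₁ σ → InWheel W₂ σ → InBoundary W₁ σ × InBoundary W₂ σ
      distinct-wheels-meet-in-boundaries W₁ W₂ W₁≥4 W₂≥4 bound₁₂ bound₂₁ W₁≉W₂ σ σ∈W₁ σ∈W₂
        with boundary-or-centre W₁ σ∈W₁ | boundary-or-centre W₂ σ∈W₂
      ... | inj₁ ∂₁   | inj₁ ∂₂   = ∂₁ , ∂₂
      ... | inj₂ c₁∈σ | _         =
        contradiction (shared-centre⇒same-simplices W₁ W₂ W₁≥4 W₂≥4 bound₂₁ c₁∈σ σ∈W₂) W₁≉W₂
      ... | inj₁ _    | inj₂ c₂∈σ =
        contradiction (⇔-sym ∘ shared-centre⇒same-simplices W₂ W₁ W₂≥4 W₁≥4 bound₁₂ c₂∈σ σ∈W₁) W₁≉W₂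

dwheelBoundaryLength≤7 : {D : Complex n} (W₁ W₂ : Wheel D) → Wheel.len W₁ < 6 → Wheel.len W₂ < 6 →
                         dwheelBoundaryLength W₁ W₂ ≤ 7
dwheelBoundaryLength≤7 _ _ W₁<6 W₂<6 =
  m≤n⇒m≤1+n (+-mono-≤ (+-mono-≤ (≤-refl {2}) (ext≤2 W₁<6)) (ext≤2 W₂<6))
  where
  ext≤2 : ∀ {e} → 3 + e < 6 → e ≤ 2
  ext≤2 = s≤s⁻¹ ∘ s≤s⁻¹ ∘ s≤s⁻¹ ∘ s≤s⁻¹

lemma4p5 : ∀ {n : ℕ} (D : Complex n) → IsDisc D → Located 7 D →
             (W₁ W₂ : Wheel D) → Wheel.len W₁ < 6 → Wheel.len W₂ < 6 →
             ¬ (∀ (σ : Subset n) → InWheel W₁ σ ⇔ InWheel W₂ σ) →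
             ∀ (σ : Subset n) → InWheel W₁ σ → InWheel W₂ σ →
             InBoundary W₁ σ × InBoundary W₂ σ
lemma4p5 D (dim , _ , degree , connected , _) located W₁ W₂ W₁<6 W₂<6 =
  distinct-wheels-meet-in-boundaries D located dim (λ v u → proj₂ ∘ degree v u) connected W₁ W₂
    (4≤len D (proj₁ located) dim W₁) (4≤len D (proj₁ located) dim W₂)
    (dwheelBoundaryLength≤7 W₁ W₂ W₁<6 W₂<6) (dwheelBoundaryLength≤7 W₂ W₁ W₂<6 W₁<6)
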